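{- If $G\in\mathscr{B}$, then $e_G(a)=e_{T_G}(a)$ for all $a\in V_{T_G}$, where $T_G$ is the associated subgraph of $G$.
   Context: All graphs are finite, simple and connected. For a connected graph $H$ and $u\in V_H$, the eccentricity is $e_H(u)=\max\{d_H(u,v):v\in V_H\}$. A block is a maximal connected subgraph without a cut-vertex; $C_G$ is the set of cut-vertices of $G$. A bi-block graph is a connected graph all of whose blocks are complete bipartite graphs. $\mathscr{B}$ is the class of bi-block graphs with at least two blocks in which every block contains at most two cut-vertices of $G$. For a block $B$, $(V_1(B),V_2(B))$ is its bipartition; $B$ is a leaf block if $|V_B\cap C_G|=1$. Vertices of $G$ are labelled $v_1,\dots,v_n$. Construction of $T_G$: for a block $B$ and $i=1,2$, let $u_i$ be the non-cut-vertex of minimum label in $V_i(B)$, if it exists. If $B\neq K_{1,1}$: $NC_B=\{u_2\}$ if $|V_1(B)\cap C_G|=2$; $NC_B=\{u_1\}$ if $|V_2(B)\cap C_G|=2$; $NC_B=\{u_1,u_2\}$ if $B$ is a leaf block; $NC_B=\emptyset$ otherwise. If $B=K_{1,1}$: $NC_B=\{u_1,u_2\}\cap V_B$. $T_G$ is the subgraph of $G$ induced by $\bigcup_B NC_B\cup C_G$. -}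

module Defs where

open import Data.Nat using (ℕ; zero; suc; _≤_)
open import Data.Fin using (Fin; toℕ)
open import Data.Fin.Subset using (Subset; _∈_; _∉_; _⊆_; ⊤; ∣_∣)
open import Data.Bool using (Bool; true; false)
open import Data.Product using (Σ; ∃; ∃-syntax; _×_; _,_)
open import Data.Sum using (_⊎_)
open import Data.Empty using (⊥)
open import Relation.Nullary using (¬_)
open import Relation.Binary.PropositionalEquality using (_≡_; _≢_)

-- A finite simple graph on the vertices v₁,…,vₙ, represented as Fin n;
-- the label order is the order of Fin n (toℕ).
record Graph (n : ℕ) : Set where
  field
    adj   : Fin n → Fin n → Bool
    sym   : ∀ u v → adj u v ≡ adj v u
    irref : ∀ v → adj v v ≡ false

module _ {n : ℕ} (G : Graph n) where
  open Graph G

  Edge : Fin n → Fin n → Set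
  Edge u v = adj u v ≡ true

  -- Walks of length k from u to v all of whose vertices satisfy P
  -- (i.e. walks in the subgraph induced by P).
  data Walk (P : Fin n → Set) : Fin n → Fin n → ℕ → Set where
    here : ∀ {u} → P u → Walk P u u 0
    step : ∀ {u w v k} → P u → Edge u w → Walk P w v k → Walk P u v (suc k)

  Dist : (Fin n → Set) → Fin n → Fin n → ℕ → Set
  Dist P u v k = Walk P u v k × (∀ m → Walk P u v m → k ≤ m)

  Ecc : (Fin n → Set) → Fin n → ℕ → Set
  Ecc P u e = (∃[ v ] (P v × Dist P u v e))
            × (∀ v → P v → ∃[ k ] (Dist P u v k × k ≤ e))

  InS : Subset n → Fin n → Set
  InS S v = v ∈ S

  Connected : Subset n → Set
  Connected S = ∀ u v → u ∈ S → v ∈ S → ∃[ k ] Walk (InS S) u v k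

  CutIn : Subset n → Fin n → Set
  CutIn S v = v ∈ S × ∃[ x ] ∃[ y ]
    (x ∈ S × y ∈ S × x ≢ v × y ≢ v
     × ¬ (∃[ k ] Walk (λ w → w ∈ S × w ≢ v) x y k))

  Cut : Fin n → Set
  Cut = CutIn ⊤

  -- S is (the vertex set of) a block: a maximal connected subgraph without
  -- a cut-vertex (blocks are induced subgraphs).
  Block : Subset n → Set
  Block S = Connected S × (∀ v → ¬ CutIn S v)
          × (∀ S′ → S ⊆ S′ → Connected S′ → (∀ v → ¬ CutIn S′ v) → S′ ⊆ S)

  CompleteBipartite : Subset n → Subset n → Subset n → Set
  CompleteBipartite S V₁ V₂ =
      V₁ ⊆ S × V₂ ⊆ S
    × (∀ v → v ∈ S → (v ∈ V₁ ⊎ v ∈ V₂))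
    × (∀ v → v ∈ V₁ → v ∉ V₂)
    × (∃[ x ] x ∈ V₁) × (∃[ y ] y ∈ V₂)
    × (∀ x y → x ∈ V₁ → y ∈ V₂ → Edge x y)
    × (∀ x y → x ∈ V₁ → y ∈ V₁ → ¬ Edge x y)
    × (∀ x y → x ∈ V₂ → y ∈ V₂ → ¬ Edge x y)

  AtMostTwoCut : Subset n → Set
  AtMostTwoCut S = ∀ x y z → x ∈ S → y ∈ S → z ∈ S → Cut x → Cut y → Cut z
                 → x ≡ y ⊎ x ≡ z ⊎ y ≡ z

  TwoCut : Subset n → Set
  TwoCut V = ∃[ x ] ∃[ y ] (x ≢ y × x ∈ V × y ∈ V × Cut x × Cut y
             × (∀ z → z ∈ V → Cut z → z ≡ x ⊎ z ≡ y))

  LeafBlock : Subset n → Set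
  LeafBlock S = ∃[ c ] (c ∈ S × Cut c × (∀ z → z ∈ S → Cut z → z ≡ c))

  MinNonCut : Subset n → Fin n → Set
  MinNonCut V x = x ∈ V × ¬ Cut x × (∀ y → y ∈ V → ¬ Cut y → toℕ x ≤ toℕ y)

  IsK11 : Subset n → Subset n → Set
  IsK11 V₁ V₂ = ∣ V₁ ∣ ≡ 1 × ∣ V₂ ∣ ≡ 1

  NC : Subset n → Subset n → Subset n → Fin n → Set
  NC B V₁ V₂ x =
      (IsK11 V₁ V₂ × (MinNonCut V₁ x ⊎ MinNonCut V₂ x))
    ⊎ (¬ IsK11 V₁ V₂ ×
        (  (TwoCut V₁ × MinNonCut V₂ x)
         ⊎ (TwoCut V₂ × MinNonCut V₁ x)
         ⊎ (LeafBlock B × (MinNonCut V₁ x ⊎ MinNonCut V₂ x))))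

  TVert : Fin n → Set
  TVert x = Cut x ⊎ ∃[ B ] ∃[ V₁ ] ∃[ V₂ ]
              (Block B × CompleteBipartite B V₁ V₂ × NC B V₁ V₂ x)

  InClassB : Set
  InClassB = Connected ⊤
           × (∀ B → Block B → ∃[ V₁ ] ∃[ V₂ ] CompleteBipartite B V₁ V₂)
           × (∃[ B ] ∃[ B′ ] (Block B × Block B′ × B ≢ B′))
           × (∀ B → Block B → AtMostTwoCut B)

-- Fix a ∈ T_G and let d be the distance in G.  T_G is isometric in G: a vertex p ∉ T_G on a
-- geodesic from a is a non-cut vertex, so both its neighbours on the geodesic lie in its block
-- B, in the part opposite to p; every part of every block contains a vertex of T_G (a cut-vertex,
-- or the least non-cut vertex chosen by NC_B), and such a vertex can replace p.  Moreover every
-- vertex v has a vertex of T_G at least as far from a: behind any cut-vertex c, on the side away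
-- from a, there is a vertex of T_G farther than c.  This handles a v whose geodesic predecessor
-- is a cut-vertex; otherwise v and its last two geodesic predecessors lie in one block, and the
-- cut-vertices of that block together with the leaf-block choice of NC_B supply the vertex.
-- So a farthest vertex from a in G is matched by one in T_G, at the same distance in both.

module Submission where

open import Defs
open import Data.Nat using (ℕ; zero; suc; _+_; _≤_; _<_; _≤?_; z≤n; s≤s)
import Data.Nat as ℕ
open import Data.Nat.Properties
  using ( ≤-refl; ≤-trans; ≤-pred; ≤-antisym; ≤-reflexive; ≮⇒≥; ≰⇒>; <⇒≤; <⇒≱; ≤∧≢⇒<
        ; n≤0⇒n≡0; n≮n; n≤1+n; m≤n⇒m≤1+n; m≤n+m; m<m+n; +-suc; +-identityʳ
        ; suc-injective; 0≢1+n; module ≤-Reasoning )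
open import Data.Fin using (Fin; toℕ; fromℕ<) renaming (zero to fz; suc to fs)
open import Data.Fin.Properties using (_≟_; any?; all?; injective⇒≤; toℕ-fromℕ<)
open import Data.Fin.Subset using (Subset; _∈_; _∉_; _⊆_; _⊃_; ⊤; ⁅_⁆; _∪_; ∣_∣)
open import Data.Fin.Subset.Properties
  using (_∈?_; ∈⊤; anySubset?; _⊂?_; ⊆-antisym; x∈⁅x⁆; x∈⁅y⁆⇒x≡y; x∈p∪q⁻; x∈p∪q⁺)
open import Data.Fin.Subset.Induction using (⊃-wellFounded; Acc; acc)
open import Data.Bool using (true)
import Data.Bool.Properties as Bool
open import Data.Product using (Σ; ∃-syntax; ∃₂; _×_; _,_; proj₁; proj₂)
open import Data.Sum using (_⊎_; inj₁; inj₂)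
import Data.Sum as Sum
open import Data.Unit using (tt) renaming (⊤ to Unit)
open import Data.Empty using (⊥; ⊥-elim)
open import Function using (_∘′_)
open import Relation.Nullary using (¬_; Dec; yes; no)
open import Relation.Nullary.Decidable using (_×-dec_; ¬?; _→-dec_)
open import Relation.Binary.PropositionalEquality
  using (_≡_; _≢_; refl; sym; trans; cong; subst)

least-ℕ : (Q : ℕ → Set) → (∀ m → Dec (Q m)) → ∀ {k} → Q k
        → ∃[ m ] (Q m × (∀ m′ → Q m′ → m ≤ m′))
least-ℕ Q Q? {k} qk = search k 0 (+-identityʳ k) (λ _ ())
  where
  search : ∀ fuel i → fuel + i ≡ k → (∀ m → m < i → ¬ Q m)
         → ∃[ m ] (Q m × (∀ m′ → Q m′ → m ≤ m′))
  search fuel i eq below with Q? i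
  ... | yes q = i , q , λ m′ q′ → ≮⇒≥ (λ lt → below m′ lt q′)
  search zero    i refl below | no ¬q = ⊥-elim (¬q qk)
  search (suc f) i eq   below | no ¬q = search f (suc i) (trans (+-suc f i) eq) below′
    where
    below′ : ∀ m → m < suc i → ¬ Q m
    below′ m (s≤s m≤i) with m ℕ.≟ i
    ... | yes refl = ¬q
    ... | no m≢i   = below m (≤∧≢⇒< m≤i m≢i)

least-Fin : ∀ {m} (Q : Fin m → Set) → (∀ x → Dec (Q x)) → ∀ {x} → Q x
          → ∃[ u ] (Q u × (∀ y → Q y → toℕ u ≤ toℕ y))
least-Fin {suc m} Q Q? {x} qx with Q? fz
... | yes q₀ = fz , q₀ , λ _ _ → z≤n
least-Fin {suc m} Q Q? {fz}   qx | no ¬q₀ = ⊥-elim (¬q₀ qx)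
least-Fin {suc m} Q Q? {fs x} qx | no ¬q₀ with least-Fin (λ y → Q (fs y)) (λ y → Q? (fs y)) qx
... | u , qu , least = fs u , qu , λ { fz q → ⊥-elim (¬q₀ q) ; (fs y) q → s≤s (least y q) }

argmax-Fin : ∀ {m} (f : Fin m → ℕ) → Fin m → ∃[ v ] (∀ w → f w ≤ f v)
argmax-Fin {suc zero}    f _ = fz , λ { fz → ≤-refl }
argmax-Fin {suc (suc m)} f _ with argmax-Fin (λ i → f (fs i)) fz
... | v , max with f fz ≤? f (fs v)
... | yes f₀≤ = fs v , λ { fz → f₀≤ ; (fs w) → max w }
... | no  f₀≰ = fz , λ { fz → ≤-refl ; (fs w) → ≤-trans (max w) (<⇒≤ (≰⇒> f₀≰)) }

module Walks {n : ℕ} (G : Graph n) where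
  open Graph G using (adj; irref) renaming (sym to adj-sym)

  Edge-sym : ∀ {u v} → Edge G u v → Edge G v u
  Edge-sym {u} {v} e = trans (adj-sym v u) e

  Edge⇒≢ : ∀ {u v} → Edge G u v → u ≢ v
  Edge⇒≢ {u} e refl with trans (sym e) (irref u)
  ... | ()

  Edge? : ∀ u v → Dec (Edge G u v)
  Edge? u v = adj u v Bool.≟ true

  private
    variable
      P Q : Fin n → Set
      u v w x : Fin n
      i j k : ℕ

  source-sat : Walk G P u v k → P u
  source-sat (here p)     = p
  source-sat (step p _ _) = p

  length-zero : Walk G P u v 0 → u ≡ v
  length-zero (here _) = refl

  _∈ʷ_ : Fin n → Walk G P u v k → Set
  x ∈ʷ here {u = u} _     = x ≡ u
  x ∈ʷ step {u = u} _ _ W = x ≡ u ⊎ x ∈ʷ W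

  source-∈ʷ : (W : Walk G P u v k) → u ∈ʷ W
  source-∈ʷ (here _)     = refl
  source-∈ʷ (step _ _ _) = inj₁ refl

  target-∈ʷ : (W : Walk G P u v k) → v ∈ʷ W
  target-∈ʷ (here _)     = refl
  target-∈ʷ (step _ _ W) = inj₂ (target-∈ʷ W)

  ∈ʷ-sat : (W : Walk G P u v k) → x ∈ʷ W → P x
  ∈ʷ-sat (here p)     refl        = p
  ∈ʷ-sat (step p _ _) (inj₁ refl) = p
  ∈ʷ-sat (step _ _ W) (inj₂ x∈W)  = ∈ʷ-sat W x∈W

  restrict : (W : Walk G P u v k) → (∀ {x} → x ∈ʷ W → Q x) → Walk G Q u v k
  restrict (here _)     q = here (q refl)
  restrict (step _ e W) q = step (q (inj₁ refl)) e (restrict W (q ∘′ inj₂))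

  ∈ʷ-restrict⁻ : (W : Walk G P u v k) (q : ∀ {x} → x ∈ʷ W → Q x)
               → x ∈ʷ restrict W q → x ∈ʷ W
  ∈ʷ-restrict⁻ (here _)     q x∈         = x∈
  ∈ʷ-restrict⁻ (step _ _ W) q (inj₁ x≡)  = inj₁ x≡
  ∈ʷ-restrict⁻ (step _ _ W) q (inj₂ x∈)  = inj₂ (∈ʷ-restrict⁻ W _ x∈)

  ∈ʷ-restrict⁺ : (W : Walk G P u v k) (q : ∀ {x} → x ∈ʷ W → Q x)
               → x ∈ʷ W → x ∈ʷ restrict W q
  ∈ʷ-restrict⁺ (here _)     q x∈         = x∈
  ∈ʷ-restrict⁺ (step _ _ W) q (inj₁ x≡)  = inj₁ x≡
  ∈ʷ-restrict⁺ (step _ _ W) q (inj₂ x∈)  = inj₂ (∈ʷ-restrict⁺ W _ x∈)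

  map : (∀ {x} → P x → Q x) → Walk G P u v k → Walk G Q u v k
  map f W = restrict W (λ x∈W → f (∈ʷ-sat W x∈W))

  _++_ : Walk G P u v i → Walk G P v w j → Walk G P u w (i + j)
  here _     ++ W′ = W′
  step p e W ++ W′ = step p e (W ++ W′)

  snoc : Walk G P u v k → P w → Edge G v w → Walk G P u w (suc k)
  snoc (here p)     pw e′ = step p e′ (here pw)
  snoc (step p e W) pw e′ = step p e (snoc W pw e′)

  reverse : Walk G P u v k → Walk G P v u k
  reverse (here p)     = here p
  reverse (step p e W) = snoc (reverse W) p (Edge-sym e)

  split : (W : Walk G P u v k) → x ∈ʷ W
        → ∃₂ λ i j → i + j ≡ k × Walk G P u x i × Walk G P x v j
  split (here p) refl = 0 , 0 , refl , here p , here p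
  split {k = suc k} (step p e W) (inj₁ refl) = 0 , suc k , refl , here p , step p e W
  split (step p e W) (inj₂ x∈W) with split W x∈W
  ... | i , j , eq , W₁ , W₂ = suc i , j , cong suc eq , step p e W₁ , W₂

  Avoiding : (Fin n → Set) → Fin n → Fin n → Set
  Avoiding P c x = P x × x ≢ c

  avoid-or-visit : ∀ c (W : Walk G P u v k) → Walk G (Avoiding P c) u v k ⊎ c ∈ʷ W
  avoid-or-visit {u = u} c (here p) with u ≟ c
  ... | yes refl = inj₂ refl
  ... | no u≢c   = inj₁ (here (p , u≢c))
  avoid-or-visit {u = u} c (step p e W) with u ≟ c | avoid-or-visit c W
  ... | yes refl | _        = inj₂ (inj₁ refl)
  ... | no u≢c   | inj₁ W′  = inj₁ (step (p , u≢c) e W′)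
  ... | no _     | inj₂ c∈W = inj₂ (inj₂ c∈W)

  Walk? : (∀ x → Dec (P x)) → ∀ k u v → Dec (Walk G P u v k)
  Walk? P? zero u v with P? u | u ≟ v
  ... | yes p | yes refl = yes (here p)
  ... | no ¬p | _        = no λ { (here p) → ¬p p }
  ... | _     | no u≢v   = no λ { (here _) → u≢v refl }
  Walk? P? (suc k) u v with P? u | any? (λ w → Edge? u w ×-dec Walk? P? k w v)
  ... | yes p | yes (w , e , W) = yes (step p e W)
  ... | no ¬p | _               = no λ { (step p _ _) → ¬p p }
  ... | _     | no ¬step        = no λ { (step _ e W) → ¬step (_ , e , W) }

  NoRepeats : Walk G P u v k → Set
  NoRepeats (here _)              = Unit
  NoRepeats (step {u = u} _ _ W) = ¬ (u ∈ʷ W) × NoRepeats W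

  NoRepeats-restrict : (W : Walk G P u v k) (q : ∀ {x} → x ∈ʷ W → Q x)
                     → NoRepeats W → NoRepeats (restrict W q)
  NoRepeats-restrict (here _)     q _          = tt
  NoRepeats-restrict (step _ _ W) q (u∉W , nr) =
    (λ u∈ → u∉W (∈ʷ-restrict⁻ W _ u∈)) , NoRepeats-restrict W _ nr

  Shortest : Walk G P u v k → Set
  Shortest {P = P} {u} {v} {k} _ = ∀ m → Walk G P u v m → k ≤ m

  shortest⇒NoRepeats : (W : Walk G P u v k) → Shortest W → NoRepeats W
  shortest⇒NoRepeats (here _) _ = tt
  shortest⇒NoRepeats (step p e W) short = u∉W , shortest⇒NoRepeats W short′
    where
    u∉W : ¬ (_ ∈ʷ W)
    u∉W u∈W with split W u∈W
    ... | i , j , refl , _ , W₂ = <⇒≱ (s≤s (m≤n+m j i)) (short j W₂)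
    short′ : Shortest W
    short′ m W′ = ≤-pred (short (suc m) (step p e W′))

  vertex-at : Walk G P u v k → Fin (suc k) → Fin n
  vertex-at (here {u = u} _)     fz     = u
  vertex-at (step {u = u} _ _ _) fz     = u
  vertex-at (step _ _ W)         (fs i) = vertex-at W i

  vertex-at-∈ʷ : (W : Walk G P u v k) → ∀ i → vertex-at W i ∈ʷ W
  vertex-at-∈ʷ (here _)     fz     = refl
  vertex-at-∈ʷ (step _ _ _) fz     = inj₁ refl
  vertex-at-∈ʷ (step _ _ W) (fs i) = inj₂ (vertex-at-∈ʷ W i)

  vertex-at-injective : (W : Walk G P u v k) → NoRepeats W
                      → ∀ {i j} → vertex-at W i ≡ vertex-at W j → i ≡ j
  vertex-at-injective (here _)     _          {fz}   {fz}   _  = refl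
  vertex-at-injective (step _ _ _) _          {fz}   {fz}   _  = refl
  vertex-at-injective (step _ _ W) (u∉W , _)  {fz}   {fs j} eq =
    ⊥-elim (u∉W (subst (_∈ʷ W) (sym eq) (vertex-at-∈ʷ W j)))
  vertex-at-injective (step _ _ W) (u∉W , _)  {fs i} {fz}   eq =
    ⊥-elim (u∉W (subst (_∈ʷ W) eq (vertex-at-∈ʷ W i)))
  vertex-at-injective (step _ _ W) (_ , nr)   {fs i} {fs j} eq =
    cong fs (vertex-at-injective W nr eq)

  NoRepeats⇒length< : (W : Walk G P u v k) → NoRepeats W → k < n
  NoRepeats⇒length< W nr = injective⇒≤ (vertex-at-injective W nr)

  Reach : (Fin n → Set) → Fin n → Fin n → Set
  Reach P u v = ∃[ k ] Walk G P u v k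

  reach-trans : Reach P u v → Reach P v w → Reach P u w
  reach-trans (i , W₁) (j , W₂) = i + j , W₁ ++ W₂

  reach-sym : Reach P u v → Reach P v u
  reach-sym (k , W) = k , reverse W

  reach-end-avoiding : ∀ {s t} (W : Walk G P s t k) → NoRepeats W → ∀ c → x ∈ʷ W → x ≢ c
                     → Reach (Avoiding P c) x s ⊎ Reach (Avoiding P c) x t
  reach-end-avoiding (here p)     _ c refl        x≢c = inj₁ (0 , here (p , x≢c))
  reach-end-avoiding (step p e W) _ c (inj₁ refl) x≢c = inj₁ (0 , here (p , x≢c))
  reach-end-avoiding {s = s} (step p e W) (s∉W , nr) c (inj₂ x∈W) x≢c
    with reach-end-avoiding W nr c x∈W x≢c
  ... | inj₂ r = inj₂ r
  ... | inj₁ (j , R) with s ≟ c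
  ... | no s≢c   = inj₁ (suc j , snoc R (p , s≢c) (Edge-sym e))
  ... | yes refl with avoid-or-visit c W
  ... | inj₁ W′  = inj₂ (_ , R ++ W′)
  ... | inj₂ c∈W = ⊥-elim (s∉W c∈W)

  shortest-walk : (∀ x → Dec (P x)) → ∀ {u v k} → Walk G P u v k
                → ∃[ m ] Σ (Walk G P u v m) Shortest
  shortest-walk P? {u} {v} = least-ℕ (λ m → Walk G _ u v m) (λ m → Walk? P? m u v)

  Reach? : (∀ x → Dec (P x)) → ∀ u v → Dec (Reach P u v)
  Reach? {P} P? u v with any? (λ (i : Fin n) → Walk? P? (toℕ i) u v)
  ... | yes (i , W) = yes (toℕ i , W)
  ... | no ¬short   = no λ (_ , W) → unreachable W
    where
    unreachable : Walk G P u v k → ⊥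
    unreachable W with shortest-walk P? W
    ... | m , W′ , short =
      ¬short (fromℕ< m<n , subst (λ l → Walk G P u v l) (sym (toℕ-fromℕ< m<n)) W′)
      where m<n = NoRepeats⇒length< W′ (shortest⇒NoRepeats W′ short)

  vertices : Walk G P u v k → Subset n
  vertices (here {u = u} _)     = ⁅ u ⁆
  vertices (step {u = u} _ _ W) = ⁅ u ⁆ ∪ vertices W

  ∈vertices⇒∈ʷ : (W : Walk G P u v k) → x ∈ vertices W → x ∈ʷ W
  ∈vertices⇒∈ʷ (here _) x∈ = x∈⁅y⁆⇒x≡y _ x∈
  ∈vertices⇒∈ʷ (step {u = u} _ _ W) x∈ with x∈p∪q⁻ ⁅ u ⁆ (vertices W) x∈
  ... | inj₁ x∈⁅u⁆ = inj₁ (x∈⁅y⁆⇒x≡y _ x∈⁅u⁆)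
  ... | inj₂ x∈W   = inj₂ (∈vertices⇒∈ʷ W x∈W)

  ∈ʷ⇒∈vertices : (W : Walk G P u v k) → x ∈ʷ W → x ∈ vertices W
  ∈ʷ⇒∈vertices (here _)     refl        = x∈⁅x⁆ _
  ∈ʷ⇒∈vertices (step _ _ _) (inj₁ refl) = x∈p∪q⁺ (inj₁ (x∈⁅x⁆ _))
  ∈ʷ⇒∈vertices (step _ _ W) (inj₂ x∈W)  = x∈p∪q⁺ (inj₂ (∈ʷ⇒∈vertices W x∈W))

module Blocks {n : ℕ} (G : Graph n) where
  open Walks G

  private
    variable
      P : Fin n → Set
      S B : Subset n
      u v w x y z c : Fin n
      k : ℕ

  CutFree : Subset n → Set
  CutFree S = ∀ v → ¬ CutIn G S v

  InS? : ∀ S x → Dec (InS G S x)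
  InS? S x = x ∈? S

  Avoiding? : (∀ x → Dec (P x)) → ∀ c x → Dec (Avoiding P c x)
  Avoiding? P? c x = P? x ×-dec ¬? (x ≟ c)

  CutIn? : ∀ S v → Dec (CutIn G S v)
  CutIn? S v = (v ∈? S) ×-dec any? λ x → any? λ y →
    (x ∈? S) ×-dec (y ∈? S) ×-dec ¬? (x ≟ v) ×-dec ¬? (y ≟ v)
    ×-dec ¬? (Reach? (Avoiding? (InS? S) v) x y)

  Cut? : ∀ v → Dec (Cut G v)
  Cut? = CutIn? ⊤

  CutFree? : ∀ S → Dec (CutFree S)
  CutFree? S = all? λ v → ¬? (CutIn? S v)

  Connected? : ∀ S → Dec (Connected G S)
  Connected? S = all? λ u → all? λ v →
    (u ∈? S) →-dec ((v ∈? S) →-dec Reach? (InS? S) u v)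

  reach-avoiding-in-CutFree : Connected G S → CutFree S
    → ∀ v {x y} → x ∈ S → y ∈ S → x ≢ v → y ≢ v → Reach (Avoiding (InS G S) v) x y
  reach-avoiding-in-CutFree {S} conn free v {x} {y} x∈S y∈S x≢v y≢v
    with Reach? (Avoiding? (InS? S) v) x y
  ... | yes r = r
  ... | no ¬r with v ∈? S
  ... | yes v∈S = ⊥-elim (free v (v∈S , x , y , x∈S , y∈S , x≢v , y≢v , ¬r))
  ... | no  v∉S = let (k , W) = conn x y x∈S y∈S
                  in k , map (λ {w} w∈S → w∈S , λ { refl → v∉S w∈S }) W

  reach-avoiding-non-cut : ¬ Cut G v → x ≢ v → y ≢ v → Reach (Avoiding (InS G ⊤) v) x y
  reach-avoiding-non-cut {v} {x} {y} ¬cut x≢v y≢v with Reach? (Avoiding? (InS? ⊤) v) x y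
  ... | yes r = r
  ... | no ¬r = ⊥-elim (¬cut (∈⊤ , x , y , ∈⊤ , ∈⊤ , x≢v , y≢v , ¬r))

  grow-to-block : Connected G S → CutFree S → ∃[ B ] (Block G B × S ⊆ B)
  grow-to-block {S₀} conn₀ free₀ = grow S₀ (⊃-wellFounded S₀) (λ x∈ → x∈) conn₀ free₀
    where
    grow : ∀ S → Acc _⊃_ S → S₀ ⊆ S → Connected G S → CutFree S
         → ∃[ B ] (Block G B × S₀ ⊆ B)
    grow S (acc rs) S₀⊆S conn free
      with anySubset? (λ S′ → (S ⊂? S′) ×-dec Connected? S′ ×-dec CutFree? S′)
    ... | yes (S′ , S⊂S′ , conn′ , free′) =
      grow S′ (rs S⊂S′) (λ x∈ → proj₁ S⊂S′ (S₀⊆S x∈)) conn′ free′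
    ... | no ¬larger = S , (conn , free , maximal) , S₀⊆S
      where
      maximal : ∀ S′ → S ⊆ S′ → Connected G S′ → CutFree S′ → S′ ⊆ S
      maximal S′ S⊆S′ conn′ free′ {x} x∈S′ with x ∈? S
      ... | yes x∈S = x∈S
      ... | no  x∉S = ⊥-elim (¬larger (S′ , (S⊆S′ , x , x∈S′ , x∉S) , conn′ , free′))

  CutFree-⊆pair : (∀ {w} → w ∈ S → w ≡ x ⊎ w ≡ y) → CutFree S
  CutFree-⊆pair {S} {x} {y} ⊆pair v (v∈S , x₁ , y₁ , x₁∈S , y₁∈S , x₁≢v , y₁≢v , ¬reach) =
    ¬reach (0 , subst (λ t → Walk G (Avoiding (InS G S) v) x₁ t 0)
                      (x₁≡y₁ (⊆pair v∈S) (⊆pair x₁∈S) (⊆pair y₁∈S) x₁≢v y₁≢v)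
                      (here (x₁∈S , x₁≢v)))
    where
    x₁≡y₁ : ∀ {v x₁ y₁} → v ≡ x ⊎ v ≡ y → x₁ ≡ x ⊎ x₁ ≡ y → y₁ ≡ x ⊎ y₁ ≡ y
          → x₁ ≢ v → y₁ ≢ v → x₁ ≡ y₁
    x₁≡y₁ _           (inj₁ refl) (inj₁ refl) _ _ = refl
    x₁≡y₁ _           (inj₂ refl) (inj₂ refl) _ _ = refl
    x₁≡y₁ (inj₁ refl) (inj₁ refl) (inj₂ refl) x₁≢v _ = ⊥-elim (x₁≢v refl)
    x₁≡y₁ (inj₂ refl) (inj₁ refl) (inj₂ refl) _ y₁≢v = ⊥-elim (y₁≢v refl)
    x₁≡y₁ (inj₁ refl) (inj₂ refl) (inj₁ refl) _ y₁≢v = ⊥-elim (y₁≢v refl)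
    x₁≡y₁ (inj₂ refl) (inj₂ refl) (inj₁ refl) x₁≢v _ = ⊥-elim (x₁≢v refl)

  ∈pair⁻ : w ∈ ⁅ x ⁆ ∪ ⁅ y ⁆ → w ≡ x ⊎ w ≡ y
  ∈pair⁻ {x = x} {y} w∈ = Sum.map (x∈⁅y⁆⇒x≡y x) (x∈⁅y⁆⇒x≡y y) (x∈p∪q⁻ ⁅ x ⁆ ⁅ y ⁆ w∈)

  pair-Connected : Edge G x y → Connected G (⁅ x ⁆ ∪ ⁅ y ⁆)
  pair-Connected e u v u∈ v∈ with ∈pair⁻ u∈ | ∈pair⁻ v∈
  ... | inj₁ refl | inj₁ refl = 0 , here u∈
  ... | inj₂ refl | inj₂ refl = 0 , here u∈
  ... | inj₁ refl | inj₂ refl = 1 , step u∈ e (here v∈)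
  ... | inj₂ refl | inj₁ refl = 1 , step u∈ (Edge-sym e) (here v∈)

  singleton-Connected : Connected G ⁅ z ⁆
  singleton-Connected {z} u v u∈ v∈ with x∈⁅y⁆⇒x≡y z u∈ | x∈⁅y⁆⇒x≡y z v∈
  ... | refl | refl = 0 , here u∈

  edge-in-block : Edge G x y → ∃[ B ] (Block G B × x ∈ B × y ∈ B)
  edge-in-block {x} {y} e with grow-to-block (pair-Connected e) (CutFree-⊆pair ∈pair⁻)
  ... | B , block , pair⊆B = B , block , pair⊆B (x∈p∪q⁺ (inj₁ (x∈⁅x⁆ x)))
                                       , pair⊆B (x∈p∪q⁺ (inj₂ (x∈⁅x⁆ y)))

  ∪-Connected : ∀ {S₁ S₂} → Connected G S₁ → Connected G S₂ → x ∈ S₁ → x ∈ S₂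
              → Connected G (S₁ ∪ S₂)
  ∪-Connected {x} {S₁} {S₂} conn₁ conn₂ x∈₁ x∈₂ u w u∈ w∈ =
    reach-trans (to-x u∈) (reach-sym (to-x w∈))
    where
    to-x : ∀ {u} → u ∈ S₁ ∪ S₂ → Reach (InS G (S₁ ∪ S₂)) u x
    to-x {u} u∈ with x∈p∪q⁻ S₁ S₂ u∈
    ... | inj₁ u∈₁ = let (k , W) = conn₁ u x u∈₁ x∈₁ in k , map (x∈p∪q⁺ ∘′ inj₁) W
    ... | inj₂ u∈₂ = let (k , W) = conn₂ u x u∈₂ x∈₂ in k , map (x∈p∪q⁺ ∘′ inj₂) W

  ∪-CutFree : ∀ {S₁ S₂} → Connected G S₁ → CutFree S₁ → Connected G S₂ → CutFree S₂
            → x ≢ y → x ∈ S₁ → x ∈ S₂ → y ∈ S₁ → y ∈ S₂ → CutFree (S₁ ∪ S₂)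
  ∪-CutFree {x} {y} {S₁} {S₂} conn₁ free₁ conn₂ free₂ x≢y x∈₁ x∈₂ y∈₁ y∈₂
            v (_ , x₁ , y₁ , x₁∈ , y₁∈ , x₁≢v , y₁≢v , ¬reach) =
    let (s , s≢v , s∈₁ , s∈₂) = shared
    in ¬reach (reach-trans (to s≢v s∈₁ s∈₂ x₁∈ x₁≢v) (reach-sym (to s≢v s∈₁ s∈₂ y₁∈ y₁≢v)))
    where
    shared : ∃[ s ] (s ≢ v × s ∈ S₁ × s ∈ S₂)
    shared with x ≟ v
    ... | no  x≢v  = x , x≢v , x∈₁ , x∈₂
    ... | yes refl = y , (λ y≡x → x≢y (sym y≡x)) , y∈₁ , y∈₂
    to : ∀ {s u} → s ≢ v → s ∈ S₁ → s ∈ S₂ → u ∈ S₁ ∪ S₂ → u ≢ v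
       → Reach (Avoiding (InS G (S₁ ∪ S₂)) v) u s
    to s≢v s∈₁ s∈₂ u∈ u≢v with x∈p∪q⁻ S₁ S₂ u∈
    ... | inj₁ u∈₁ =
      let (k , W) = reach-avoiding-in-CutFree conn₁ free₁ v u∈₁ s∈₁ u≢v s≢v
      in k , map (λ (w∈ , w≢v) → x∈p∪q⁺ (inj₁ w∈) , w≢v) W
    ... | inj₂ u∈₂ =
      let (k , W) = reach-avoiding-in-CutFree conn₂ free₂ v u∈₂ s∈₂ u≢v s≢v
      in k , map (λ (w∈ , w≢v) → x∈p∪q⁺ (inj₂ w∈) , w≢v) W

  cycle-Connected-CutFree : Edge G x y → Edge G x z → Reach (Avoiding (InS G ⊤) x) y z
    → ∃[ C ] (Connected G C × CutFree C × x ∈ C × y ∈ C × z ∈ C)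
  cycle-Connected-CutFree {x} {y} {z} x~y x~z (_ , W₀)
    with shortest-walk (Avoiding? (InS? ⊤) x) W₀
  ... | k , W , short = C , conn , free , x∈C , on-W (source-∈ʷ W) , on-W (target-∈ʷ W)
    -- W repeats no vertex, so deleting any vertex v ≠ x leaves every other vertex of W
    -- attached to an end of W, hence to x.
    where
    C : Subset n
    C = ⁅ x ⁆ ∪ vertices W
    x∈C : x ∈ C
    x∈C = x∈p∪q⁺ (inj₁ (x∈⁅x⁆ x))
    on-W : ∀ {w} → w ∈ʷ W → w ∈ C
    on-W w∈W = x∈p∪q⁺ (inj₂ (∈ʷ⇒∈vertices W w∈W))
    Wₛ : Walk G (Avoiding (InS G C) x) y z k
    Wₛ = restrict W (λ w∈W → on-W w∈W , proj₂ (∈ʷ-sat W w∈W))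
    x-or-on-Wₛ : ∀ {u} → u ∈ C → u ≡ x ⊎ u ∈ʷ Wₛ
    x-or-on-Wₛ {u} u∈C = Sum.map (x∈⁅y⁆⇒x≡y x)
      (λ u∈W → ∈ʷ-restrict⁺ W _ (∈vertices⇒∈ʷ W u∈W)) (x∈p∪q⁻ ⁅ x ⁆ (vertices W) u∈C)
    to-x : ∀ {u} → u ∈ C → Reach (InS G C) u x
    to-x u∈C with x-or-on-Wₛ u∈C
    ... | inj₁ refl = 0 , here u∈C
    ... | inj₂ u∈Wₛ with split Wₛ u∈Wₛ
    ... | _ , j , _ , _ , W₂ = suc j , snoc (map proj₁ W₂) x∈C (Edge-sym x~z)
    conn : Connected G C
    conn u w u∈C w∈C = reach-trans (to-x u∈C) (reach-sym (to-x w∈C))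
    no-repeats : NoRepeats Wₛ
    no-repeats = NoRepeats-restrict W _ (shortest⇒NoRepeats W short)
    to-y-avoiding-x : ∀ {u} → u ∈ C → u ≢ x → Reach (Avoiding (InS G C) x) u y
    to-y-avoiding-x u∈C u≢x with x-or-on-Wₛ u∈C
    ... | inj₁ u≡x  = ⊥-elim (u≢x u≡x)
    ... | inj₂ u∈Wₛ with split Wₛ u∈Wₛ
    ... | i , _ , _ , W₁ , _ = i , reverse W₁
    forget-x : ∀ {v w} → Avoiding (Avoiding (InS G C) x) v w → Avoiding (InS G C) v w
    forget-x ((w∈C , _) , w≢v) = w∈C , w≢v
    to-x-avoiding : ∀ {v u} → x ≢ v → u ∈ C → u ≢ v → Reach (Avoiding (InS G C) v) u x
    to-x-avoiding {v} x≢v u∈C u≢v with x-or-on-Wₛ u∈C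
    ... | inj₁ refl = 0 , here (u∈C , u≢v)
    ... | inj₂ u∈Wₛ with reach-end-avoiding Wₛ no-repeats v u∈Wₛ u≢v
    ... | inj₁ (j , R) = suc j , snoc (map forget-x R) (x∈C , x≢v) (Edge-sym x~y)
    ... | inj₂ (j , R) = suc j , snoc (map forget-x R) (x∈C , x≢v) (Edge-sym x~z)
    free : CutFree C
    free v (_ , x₁ , y₁ , x₁∈ , y₁∈ , x₁≢v , y₁≢v , ¬reach) with x ≟ v
    ... | yes refl = ¬reach (reach-trans (to-y-avoiding-x x₁∈ x₁≢v)
                                         (reach-sym (to-y-avoiding-x y₁∈ y₁≢v)))
    ... | no  x≢v  = ¬reach (reach-trans (to-x-avoiding x≢v x₁∈ x₁≢v)
                                         (reach-sym (to-x-avoiding x≢v y₁∈ y₁≢v)))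

  block-∋-detour : Block G B → x ∈ B → y ∈ B → Edge G x y → Edge G x z
                 → Reach (Avoiding (InS G ⊤) x) y z → z ∈ B
  block-∋-detour {B} (connB , freeB , maximal) x∈B y∈B x~y x~z y⇝z
    with cycle-Connected-CutFree x~y x~z y⇝z
  ... | C , connC , freeC , x∈C , y∈C , z∈C =
    maximal (B ∪ C) (λ w∈ → x∈p∪q⁺ (inj₁ w∈)) (∪-Connected connB connC x∈B x∈C)
            (∪-CutFree connB freeB connC freeC (Edge⇒≢ x~y) x∈B x∈C y∈B y∈C)
            (x∈p∪q⁺ (inj₂ z∈C))

  non-cut-neighbour∈block : Block G B → ¬ Cut G x → x ∈ B → y ∈ B → Edge G x y → Edge G x z
                          → z ∈ B
  non-cut-neighbour∈block block ¬cut x∈B y∈B x~y x~z =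
    block-∋-detour block x∈B y∈B x~y x~z
      (reach-avoiding-non-cut ¬cut (λ y≡x → Edge⇒≢ x~y (sym y≡x)) (λ z≡x → Edge⇒≢ x~z (sym z≡x)))

  exit-edge : Walk G P u v k → u ∈ S → v ∉ S → ∃₂ λ b z → b ∈ S × z ∉ S × Edge G b z
  exit-edge (here _) u∈S v∉S = ⊥-elim (v∉S u∈S)
  exit-edge {S = S} (step {w = w} _ e W) u∈S v∉S with w ∈? S
  ... | yes w∈S = exit-edge W w∈S v∉S
  ... | no  w∉S = _ , w , u∈S , w∉S , e

  neighbour-in : Connected G S → x ∈ S → y ∈ S → x ≢ y → ∃[ x′ ] (x′ ∈ S × Edge G x x′)
  neighbour-in conn x∈S y∈S x≢y with conn _ _ x∈S y∈S
  ... | zero  , W          = ⊥-elim (x≢y (length-zero W))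
  ... | suc _ , step _ e W = _ , source-sat W , e

  cut-free-block-spans : Connected G ⊤ → Block G B → (∀ c → c ∈ B → ¬ Cut G c) → ∀ z → z ∈ B
  cut-free-block-spans {B} connG block@(connB , _ , maximal) no-cut z with z ∈? B
  ... | yes z∈B = z∈B
  ... | no  z∉B with any? (λ b → b ∈? B)
  ... | no B-empty = maximal ⁅ z ⁆ (λ {b} b∈B → ⊥-elim (B-empty (b , b∈B))) singleton-Connected
                             (CutFree-⊆pair {y = z} (inj₁ ∘′ x∈⁅y⁆⇒x≡y z)) (x∈⁅x⁆ z)
  ... | yes (b , b∈B) with exit-edge (proj₂ (connG b z ∈⊤ ∈⊤)) b∈B z∉B
  ... | b′ , z′ , b′∈B , z′∉B , b′~z′ with any? (λ y → (y ∈? B) ×-dec ¬? (b′ ≟ y))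
  ... | yes (y , y∈B , b′≢y) =
    let (y′ , y′∈B , b′~y′) = neighbour-in connB b′∈B y∈B b′≢y
    in ⊥-elim (z′∉B (non-cut-neighbour∈block block (no-cut b′ b′∈B) b′∈B y′∈B b′~y′ b′~z′))
  ... | no ¬other = ⊥-elim (z′∉B (maximal (⁅ b′ ⁆ ∪ ⁅ z′ ⁆) B⊆pair (pair-Connected b′~z′)
                                   (CutFree-⊆pair ∈pair⁻) (x∈p∪q⁺ (inj₂ (x∈⁅x⁆ z′)))))
    where
    B⊆pair : B ⊆ ⁅ b′ ⁆ ∪ ⁅ z′ ⁆
    B⊆pair {y} y∈B with b′ ≟ y
    ... | yes refl = x∈p∪q⁺ (inj₁ (x∈⁅x⁆ y))
    ... | no b′≢y  = ⊥-elim (¬other (y , y∈B , b′≢y))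

  block-∋-cut : Connected G ⊤ → (∃[ B₁ ] ∃[ B₂ ] (Block G B₁ × Block G B₂ × B₁ ≢ B₂))
              → Block G B → ∃[ c ] (c ∈ B × Cut G c)
  block-∋-cut {B} connG (B₁ , B₂ , block₁ , block₂ , B₁≢B₂) block@(connB , freeB , _)
    with any? (λ c → (c ∈? B) ×-dec Cut? c)
  ... | yes has-cut = has-cut
  ... | no ¬has-cut = ⊥-elim (B₁≢B₂ (trans (≡B block₁) (sym (≡B block₂))))
    where
    B-spans : ∀ z → z ∈ B
    B-spans = cut-free-block-spans connG block (λ c c∈B cut → ¬has-cut (c , c∈B , cut))
    ≡B : ∀ {B′} → Block G B′ → B′ ≡ B
    ≡B (_ , _ , maximal′) =
      ⊆-antisym (λ {z} _ → B-spans z) (maximal′ B (λ {z} _ → B-spans z) connB freeB)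

  module _ {B X Y : Subset n} where

    X⊆B : CompleteBipartite G B X Y → X ⊆ B
    X⊆B (X⊆B , _) = X⊆B

    Y⊆B : CompleteBipartite G B X Y → Y ⊆ B
    Y⊆B (_ , Y⊆B , _) = Y⊆B

    ∈X⊎∈Y : CompleteBipartite G B X Y → v ∈ B → v ∈ X ⊎ v ∈ Y
    ∈X⊎∈Y (_ , _ , parts , _) = parts _

    X-nonempty : CompleteBipartite G B X Y → ∃[ x ] x ∈ X
    X-nonempty (_ , _ , _ , _ , X≢∅ , _) = X≢∅

    Y-nonempty : CompleteBipartite G B X Y → ∃[ y ] y ∈ Y
    Y-nonempty (_ , _ , _ , _ , _ , Y≢∅ , _) = Y≢∅

    cross-edge : CompleteBipartite G B X Y → x ∈ X → y ∈ Y → Edge G x y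
    cross-edge (_ , _ , _ , _ , _ , _ , complete , _) = complete _ _

    neighbour∈opposite : CompleteBipartite G B X Y → x ∈ X → w ∈ B → Edge G x w → w ∈ Y
    neighbour∈opposite cb@(_ , _ , _ , _ , _ , _ , _ , X-independent , _) x∈X w∈B x~w
      with ∈X⊎∈Y cb w∈B
    ... | inj₂ w∈Y = w∈Y
    ... | inj₁ w∈X = ⊥-elim (X-independent _ _ x∈X w∈X x~w)

  CompleteBipartite-swap : ∀ {B X Y} → CompleteBipartite G B X Y → CompleteBipartite G B Y X
  CompleteBipartite-swap (X⊆B , Y⊆B , parts , disjoint , X≢∅ , Y≢∅ , complete , X-ind , Y-ind) =
    Y⊆B , X⊆B , (λ v v∈B → Sum.swap (parts v v∈B)) , (λ v v∈Y v∈X → disjoint v v∈X v∈Y) ,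
    Y≢∅ , X≢∅ , (λ y x y∈Y x∈X → Edge-sym (complete x y x∈X y∈Y)) , Y-ind , X-ind

  orient : ∀ {B X Y v} → CompleteBipartite G B X Y → v ∈ B
         → ∃[ X′ ] ∃[ Y′ ] (CompleteBipartite G B X′ Y′ × v ∈ X′)
  orient {X = X} {Y} cb v∈B with ∈X⊎∈Y cb v∈B
  ... | inj₁ v∈X = X , Y , cb , v∈X
  ... | inj₂ v∈Y = Y , X , CompleteBipartite-swap cb , v∈Y

module Distances {n : ℕ} (G : Graph n) (connG : Connected G ⊤) where
  open Walks G
  open Blocks G

  private
    variable
      P : Fin n → Set
      a c u v w x y : Fin n
      k : ℕ

  abstract
    geodesic-exists : ∀ u v → ∃[ k ] Σ (Walk G (InS G ⊤) u v k) Shortest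
    geodesic-exists u v = shortest-walk (InS? ⊤) (proj₂ (connG u v ∈⊤ ∈⊤))

  d : Fin n → Fin n → ℕ
  d u v = proj₁ (geodesic-exists u v)

  geodesic : ∀ u v → Walk G (InS G ⊤) u v (d u v)
  geodesic u v = proj₁ (proj₂ (geodesic-exists u v))

  d-minimal : Walk G P u v k → d u v ≤ k
  d-minimal {u = u} {v = v} W = proj₂ (proj₂ (geodesic-exists u v)) _ (map (λ _ → ∈⊤) W)

  Dist-d : Walk G P u v (d u v) → Dist G P u v (d u v)
  Dist-d W = W , λ _ → d-minimal

  d-edge : Edge G x y → d a y ≤ suc (d a x)
  d-edge {x = x} {a = a} x~y = d-minimal (snoc (geodesic a x) ∈⊤ x~y)

  d-self : ∀ u → d u u ≡ 0
  d-self u = n≤0⇒n≡0 (d-minimal (here {P = InS G ⊤} {u = u} ∈⊤))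

  d≡0⇒≡ : d u v ≡ 0 → u ≡ v
  d≡0⇒≡ {u = u} {v = v} d≡0 = length-zero (subst (Walk G (InS G ⊤) u v) d≡0 (geodesic u v))

  ≢⇒d>0 : u ≢ v → 0 < d u v
  ≢⇒d>0 {u = u} {v = v} u≢v with d u v in eq
  ... | zero  = ⊥-elim (u≢v (d≡0⇒≡ eq))
  ... | suc _ = s≤s z≤n

  first-step : Walk G P u v k → u ≢ v
             → ∃[ w ] ∃[ k′ ] (k ≡ suc k′ × Edge G u w × Walk G P w v k′)
  first-step (here _)     u≢v = ⊥-elim (u≢v refl)
  first-step (step _ e W) _   = _ , _ , refl , e , W

  geodesic-predecessor : a ≢ v → ∃[ p ] (Edge G p v × suc (d a p) ≡ d a v)
  geodesic-predecessor {a = a} {v = v} a≢v with first-step (reverse (geodesic a v)) (a≢v ∘′ sym)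
  ... | p , k′ , eq , v~p , W =
    p , Edge-sym v~p , ≤-antisym (subst (suc (d a p) ≤_) (sym eq) (s≤s (d-minimal (reverse W))))
                                 (d-edge (Edge-sym v~p))

  reach-avoiding-along-geodesic : c ≢ w → d a w ≤ d a c → Reach (Avoiding (InS G ⊤) c) a w
  reach-avoiding-along-geodesic {c = c} {w = w} {a = a} c≢w dw≤dc
    with avoid-or-visit c (geodesic a w)
  ... | inj₁ W   = _ , W
  ... | inj₂ c∈W with split (geodesic a w) c∈W
  ... | i , zero  , _  , _  , W₂ = ⊥-elim (c≢w (length-zero W₂))
  ... | i , suc j , eq , W₁ , _  = ⊥-elim (n≮n (d a c) (begin-strict
    d a c      ≤⟨ d-minimal W₁ ⟩
    i          <⟨ m<m+n i (s≤s z≤n) ⟩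
    i + suc j  ≡⟨ eq ⟩
    d a w      ≤⟨ dw≤dc ⟩
    d a c      ∎))
    where open ≤-Reasoning

  unreachable-avoiding⇒farther : c ≢ w → ¬ Reach (Avoiding (InS G ⊤) c) a w → d a c < d a w
  unreachable-avoiding⇒farther {c = c} {w = w} {a = a} c≢w ¬reach with d a w ≤? d a c
  ... | yes dw≤dc = ⊥-elim (¬reach (reach-avoiding-along-geodesic c≢w dw≤dc))
  ... | no  dw≰dc = ≰⇒> dw≰dc

  last-step-before : Walk G P x c k → x ≢ c → ∃[ x′ ] (Edge G x′ c × Reach (Avoiding P c) x x′)
  last-step-before (here _) x≢c = ⊥-elim (x≢c refl)
  last-step-before {x = x} {c = c} (step {w = w} p x~w W) x≢c with w ≟ c
  ... | yes refl = x , x~w , 0 , here (p , x≢c)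
  ... | no w≢c   = let (x′ , x′~c , k , R) = last-step-before W w≢c
                    in x′ , x′~c , suc k , step (p , x≢c) x~w R

  cut-separates : Cut G c → ∀ a → ∃[ x ] (x ≢ c × ¬ Reach (Avoiding (InS G ⊤) c) a x)
  cut-separates {c = c} (_ , x₀ , y₀ , _ , _ , x₀≢c , y₀≢c , x₀↮y₀) a
    with Reach? (Avoiding? (InS? ⊤) c) a x₀
  ... | no  a↮x₀ = x₀ , x₀≢c , a↮x₀
  ... | yes a⇝x₀ = y₀ , y₀≢c , λ a⇝y₀ → x₀↮y₀ (reach-trans (reach-sym a⇝x₀) a⇝y₀)

  cut-separated-neighbour : Cut G c → ∀ a → ∃[ x ] (Edge G c x × ¬ Reach (Avoiding (InS G ⊤) c) a x)
  cut-separated-neighbour {c = c} cut a =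
    let (x , x≢c , a↮x) = cut-separates cut a
        (x′ , x′~c , x⇝x′) = last-step-before (proj₂ (connG x c ∈⊤ ∈⊤)) x≢c
    in x′ , Edge-sym x′~c , λ a⇝x′ → a↮x (reach-trans a⇝x′ (reach-sym x⇝x′))

  Ecc-d : (∀ {w} → P w → Walk G P a w (d a w)) → P v → (∀ w → d a w ≤ d a v) → Ecc G P a (d a v)
  Ecc-d {a = a} geodesic-in-P v∈P farthest =
    (_ , v∈P , Dist-d (geodesic-in-P v∈P)) ,
    λ w w∈P → d a w , Dist-d (geodesic-in-P w∈P) , farthest w

module ClassB {n : ℕ} (G : Graph n) (cls : InClassB G) where
  open Walks G
  open Blocks G

  private
    connG = proj₁ cls
    bipartition = proj₁ (proj₂ cls)
    two-blocks = proj₁ (proj₂ (proj₂ cls))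
    at-most-two-cuts = proj₂ (proj₂ (proj₂ cls))
    variable
      B V V₁ V₂ X Y : Subset n
      c u v w x y : Fin n

  open Distances G connG

  cut-exists : ∃[ c ] Cut G c
  cut-exists with two-blocks
  ... | B₁ , _ , block₁ , _ = let (c , _ , cut) = block-∋-cut connG two-blocks block₁ in c , cut

  least-non-cut : x ∈ V → ¬ Cut G x → ∃[ u ] MinNonCut G V u
  least-non-cut {V = V} x∈V ¬cut
    with least-Fin (λ y → y ∈ V × ¬ Cut G y) (λ y → (y ∈? V) ×-dec ¬? (Cut? y)) (x∈V , ¬cut)
  ... | u , (u∈V , ¬cut-u) , least = u , u∈V , ¬cut-u , λ y y∈V ¬cut-y → least y (y∈V , ¬cut-y)

  leaf-or-second-cut : c ∈ B → Cut G c → LeafBlock G B ⊎ ∃[ c′ ] (c′ ∈ B × Cut G c′ × c′ ≢ c)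
  leaf-or-second-cut {c = c} {B = B} c∈B cut
    with any? (λ c′ → (c′ ∈? B) ×-dec Cut? c′ ×-dec ¬? (c′ ≟ c))
  ... | yes second = inj₂ second
  ... | no ¬second = inj₁ (c , c∈B , cut , only-c)
    where
    only-c : ∀ z → z ∈ B → Cut G z → z ≡ c
    only-c z z∈B cut-z with z ≟ c
    ... | yes z≡c = z≡c
    ... | no  z≢c = ⊥-elim (¬second (z , z∈B , cut-z , z≢c))

  leaf-least-non-cut∈T : Block G B → CompleteBipartite G B V₁ V₂ → LeafBlock G B
                       → MinNonCut G V₁ u ⊎ MinNonCut G V₂ u → TVert G u
  leaf-least-non-cut∈T {V₁ = V₁} {V₂} block cb leaf least with (∣ V₁ ∣ ℕ.≟ 1) ×-dec (∣ V₂ ∣ ℕ.≟ 1)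
  ... | yes k₁₁ = inj₂ (_ , V₁ , V₂ , block , cb , inj₁ (k₁₁ , least))
  ... | no ¬k₁₁ = inj₂ (_ , V₁ , V₂ , block , cb , inj₂ (¬k₁₁ , inj₂ (inj₂ (leaf , least))))

  part-∋-T : Block G B → CompleteBipartite G B X Y → ∃[ t ] (t ∈ X × TVert G t)
  part-∋-T {B = B} {X} {Y} block cb with any? (λ c → (c ∈? X) ×-dec Cut? c)
  ... | yes (c , c∈X , cut) = c , c∈X , inj₁ cut
  ... | no ¬cut-in-X with X-nonempty cb
  ... | x , x∈X with least-non-cut x∈X (λ cut → ¬cut-in-X (x , x∈X , cut))
  ... | u , least = u , proj₁ least , inj₂ (B , X , Y , block , cb , u∈NC)
    where
    cut∈Y : ∀ {z} → z ∈ B → Cut G z → z ∈ Y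
    cut∈Y {z} z∈B cut with ∈X⊎∈Y cb z∈B
    ... | inj₁ z∈X = ⊥-elim (¬cut-in-X (z , z∈X , cut))
    ... | inj₂ z∈Y = z∈Y
    u∈NC : NC G B X Y u
    u∈NC with (∣ X ∣ ℕ.≟ 1) ×-dec (∣ Y ∣ ℕ.≟ 1)
    ... | yes k₁₁ = inj₁ (k₁₁ , inj₁ least)
    ... | no ¬k₁₁ with block-∋-cut connG two-blocks block
    ... | c , c∈B , cut with leaf-or-second-cut c∈B cut
    ... | inj₁ leaf = inj₂ (¬k₁₁ , inj₂ (inj₂ (leaf , inj₁ least)))
    ... | inj₂ (c′ , c′∈B , cut′ , c′≢c) =
      inj₂ (¬k₁₁ , inj₂ (inj₁ (two-cuts , least)))
      where
      only : ∀ z → z ∈ Y → Cut G z → z ≡ c ⊎ z ≡ c′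
      only z z∈Y cut-z with at-most-two-cuts B block c c′ z c∈B c′∈B (Y⊆B cb z∈Y) cut cut′ cut-z
      ... | inj₁ c≡c′        = ⊥-elim (c′≢c (sym c≡c′))
      ... | inj₂ (inj₁ c≡z)  = inj₁ (sym c≡z)
      ... | inj₂ (inj₂ c′≡z) = inj₂ (sym c′≡z)
      two-cuts : TwoCut G Y
      two-cuts = c , c′ , c′≢c ∘′ sym , cut∈Y c∈B cut , cut∈Y c′∈B cut′ , cut , cut′ , only

  block-∋-T-≢ : Block G B → c ∈ B → Cut G c → x ∈ B → x ≢ c → ∃[ t ] (TVert G t × t ∈ B × t ≢ c)
  block-∋-T-≢ {B = B} {x = x} block c∈B cut x∈B x≢c with leaf-or-second-cut c∈B cut
  ... | inj₂ (c′ , c′∈B , cut′ , c′≢c) = c′ , inj₁ cut′ , c′∈B , c′≢c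
  ... | inj₁ leaf@(c₀ , _ , _ , only-c₀) with bipartition B block
  ... | _ , _ , cb with orient cb x∈B
  ... | X , Y , cb′ , x∈X with least-non-cut x∈X ¬cut-x
    where
    ¬cut-x : ¬ Cut G x
    ¬cut-x cut-x = x≢c (trans (only-c₀ _ x∈B cut-x) (sym (only-c₀ _ c∈B cut)))
  ... | u , least@(u∈X , ¬cut-u , _) =
    u , leaf-least-non-cut∈T block cb′ leaf (inj₁ least) , X⊆B cb′ u∈X , λ { refl → ¬cut-u cut }

  module _ (a : Fin n) where

    beyond-cut : Cut G c → ∃[ t ] (TVert G t × d a c < d a t)
    beyond-cut {c = c} cut with cut-separated-neighbour cut a
    ... | x , c~x , a↮x with edge-in-block c~x
    ... | B , block@(connB , freeB , _) , c∈B , x∈B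
      with block-∋-T-≢ block c∈B cut x∈B (Edge⇒≢ c~x ∘′ sym)
    ... | t , t∈T , t∈B , t≢c = t , t∈T , unreachable-avoiding⇒farther (t≢c ∘′ sym) a↮t
      where
      a↮t : ¬ Reach (Avoiding (InS G ⊤) c) a t
      a↮t (j , a⇝t) =
        let (k , t⇝x) = reach-avoiding-in-CutFree connB freeB c t∈B x∈B t≢c (Edge⇒≢ c~x ∘′ sym)
        in a↮x (j + k , a⇝t ++ map (λ (_ , w≢c) → ∈⊤ , w≢c) t⇝x)

    T-within-one-of-cut : Cut G c → d a v ≤ suc (d a c) → ∃[ t ] (TVert G t × d a v ≤ d a t)
    T-within-one-of-cut cut dv≤ =
      let (t , t∈T , dc<dt) = beyond-cut cut in t , t∈T , ≤-trans dv≤ dc<dt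

    T-within-two : ¬ Cut G a → d a v ≤ 2 → ∃[ t ] (TVert G t × d a v ≤ d a t)
    T-within-two ¬cut-a dv≤2 =
      let (c , cut) = cut-exists
          a≢c : a ≢ c
          a≢c a≡c = ¬cut-a (subst (Cut G) (sym a≡c) cut)
      in T-within-one-of-cut cut (≤-trans dv≤2 (s≤s (≢⇒d>0 a≢c)))

    module _ {B X Y} (block : Block G B) (cb : CompleteBipartite G B X Y)
             {p} (p∈X : p ∈ X) (¬cut-p : ¬ Cut G p) (a≢p : a ≢ p) where

      predecessor∈opposite : ∃[ q ] (q ∈ Y × suc (d a q) ≡ d a p)
      predecessor∈opposite =
        let (q , q~p , dq) = geodesic-predecessor a≢p
            (y , y∈Y) = Y-nonempty cb
            q∈B = non-cut-neighbour∈block block ¬cut-p (X⊆B cb p∈X) (Y⊆B cb y∈Y)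
                    (cross-edge cb p∈X y∈Y) (Edge-sym q~p)
        in q , neighbour∈opposite cb p∈X q∈B (Edge-sym q~p) , dq

      non-cut-farthest-in-part : ∀ {x} → x ∈ X → d a x ≤ d a p
      non-cut-farthest-in-part x∈X =
        let (q , q∈Y , dq) = predecessor∈opposite
        in subst (_ ≤_) dq (d-edge (Edge-sym (cross-edge cb x∈X q∈Y)))

    T-predecessor : TVert G a → a ≢ w → ∃[ t ] (TVert G t × Edge G t w × suc (d a t) ≡ d a w)
    T-predecessor {w = w} a∈T a≢w with geodesic-predecessor a≢w
    ... | p , p~w , dp with Cut? p | a ≟ p
    ... | yes cut-p | _        = p , inj₁ cut-p , p~w , dp
    ... | no  _     | yes refl = a , a∈T , p~w , dp
    ... | no ¬cut-p | no a≢p =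
      let (B , block , p∈B , w∈B) = edge-in-block p~w
          (X , Y , cb , p∈X) = orient (proj₂ (proj₂ (bipartition B block))) p∈B
          (t , t∈X , t∈T) = part-∋-T block cb
          t~w = cross-edge cb t∈X (neighbour∈opposite cb p∈X w∈B p~w)
          dt≡dp = ≤-antisym (non-cut-farthest-in-part block cb p∈X ¬cut-p a≢p t∈X)
                            (≤-pred (subst (_≤ suc (d a t)) (sym dp) (d-edge t~w)))
      in t , t∈T , t~w , trans (cong suc dt≡dp) dp

    T-geodesic : TVert G a → TVert G w → Walk G (TVert G) a w (d a w)
    T-geodesic {w = w} a∈T w∈T = go (d a w) refl w∈T
      where
      go : ∀ {w} k → d a w ≡ k → TVert G w → Walk G (TVert G) a w k
      go zero    dw≡0 _ = subst (λ w → Walk G (TVert G) a w 0) (d≡0⇒≡ dw≡0) (here a∈T)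
      go {w} (suc k) dw≡k w∈T with a ≟ w
      ... | yes refl = ⊥-elim (0≢1+n (trans (sym (d-self a)) dw≡k))
      ... | no  a≢w  =
        let (t , t∈T , t~w , dt) = T-predecessor a∈T a≢w
        in snoc (go k (suc-injective (trans dt dw≡k)) t∈T) w∈T t~w

    d-across : CompleteBipartite G B X Y → x ∈ X → y ∈ Y → d a x ≤ suc (d a y)
    d-across cb x∈X y∈Y = d-edge (Edge-sym (cross-edge cb x∈X y∈Y))

    module _ {B X Y} (block : Block G B) (cb : CompleteBipartite G B X Y)
             {v y z} (v∈X : v ∈ X) (¬cut-v : ¬ Cut G v) (y∈Y : y ∈ Y) (¬cut-y : ¬ Cut G y)
             (z∈X : z ∈ X) (dv : suc (d a y) ≡ d a v) (dy : suc (d a z) ≡ d a y) where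

      private
        y∈B = Y⊆B cb y∈Y
        dv≡2+dz : d a v ≡ suc (suc (d a z))
        dv≡2+dz = trans (sym dv) (cong suc (sym dy))

      source∈X⇒≡z : a ∈ X → a ≡ z
      source∈X⇒≡z a∈X = d≡0⇒≡ (n≤0⇒n≡0 (≤-pred (≤-pred (begin
        suc (suc (d a z))  ≡⟨ sym dv≡2+dz ⟩
        d a v              ≡⟨ sym dv ⟩
        suc (d a y)        ≤⟨ s≤s (d-across (CompleteBipartite-swap cb) y∈Y a∈X) ⟩
        suc (suc (d a a))  ≡⟨ cong (suc ∘′ suc) (d-self a) ⟩
        2                  ∎))))
        where open ≤-Reasoning

      no-distant-second-cut : ∀ {c′} → c′ ∈ B → Cut G c′ → c′ ≢ z
                            → suc (suc (d a c′)) ≤ d a v → ⊥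
      no-distant-second-cut {c′} c′∈B cut′ c′≢z distant with ∈X⊎∈Y cb c′∈B
      ... | inj₂ c′∈Y = too-close (d-across cb v∈X c′∈Y)
        where
        too-close : d a v ≤ suc (d a c′) → ⊥
        too-close dv≤ = n≮n _ (≤-trans distant dv≤)
      ... | inj₁ c′∈X with a ≟ c′
      ...   | yes refl = c′≢z (source∈X⇒≡z c′∈X)
      -- y – z ⇝ a ⇝ q avoids c′, which puts the geodesic predecessor q of c′ into B, next to v.
      ...   | no  a≢c′ with geodesic-predecessor a≢c′
      ...   | q , q~c′ , dq =
        n≮n _ (≤-trans distant (m≤n⇒m≤1+n (subst (d a v ≤_) dq (d-across cb v∈X q∈Y))))
        where
        y≢c′ : y ≢ c′
        y≢c′ refl = ¬cut-y cut′
        dz≤dc′ : d a z ≤ d a c′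
        dz≤dc′ = ≤-pred (subst (_≤ suc (d a c′)) (sym dy)
                               (d-across (CompleteBipartite-swap cb) y∈Y c′∈X))
        y⇝q : Reach (Avoiding (InS G ⊤) c′) y q
        y⇝q = reach-trans (1 , step (∈⊤ , y≢c′) (Edge-sym (cross-edge cb z∈X y∈Y))
                                    (here (∈⊤ , c′≢z ∘′ sym)))
              (reach-trans (reach-sym (reach-avoiding-along-geodesic c′≢z dz≤dc′))
                           (reach-avoiding-along-geodesic (Edge⇒≢ q~c′ ∘′ sym)
                                                          (≤-trans (n≤1+n _) (≤-reflexive dq))))
        q∈Y : q ∈ Y
        q∈Y = neighbour∈opposite cb c′∈X
                (block-∋-detour block c′∈B y∈B (cross-edge cb c′∈X y∈Y) (Edge-sym q~c′) y⇝q)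
                (Edge-sym q~c′)

      T-at-least-as-far-as-v : ∃[ t ] (TVert G t × d a v ≤ d a t)
      T-at-least-as-far-as-v with Cut? z
      ... | no ¬cut-z with a ≟ z
      ...   | yes refl =
        T-within-two ¬cut-z (≤-reflexive (trans dv≡2+dz (cong (suc ∘′ suc) (d-self a))))
      ...   | no  a≢z  = ⊥-elim (n≮n _ (begin-strict
        d a z              <⟨ ≤-refl ⟩
        suc (d a z)        <⟨ ≤-refl ⟩
        suc (suc (d a z))  ≡⟨ sym dv≡2+dz ⟩
        d a v              ≤⟨ non-cut-farthest-in-part block cb z∈X ¬cut-z a≢z v∈X ⟩
        d a z              ∎))
        where open ≤-Reasoning
      T-at-least-as-far-as-v | yes cut-z with leaf-or-second-cut (X⊆B cb z∈X) cut-z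
      ... | inj₂ (c′ , c′∈B , cut′ , c′≢z) with d a v ≤? suc (d a c′)
      ...   | yes dv≤ = T-within-one-of-cut cut′ dv≤
      ...   | no  dv≰ = ⊥-elim (no-distant-second-cut c′∈B cut′ c′≢z (≰⇒> dv≰))
      T-at-least-as-far-as-v | yes cut-z | inj₁ leaf with least-non-cut v∈X ¬cut-v
      ... | u , least@(u∈X , ¬cut-u , _) with a ≟ u
      ...   | yes refl = ⊥-elim (¬cut-u (subst (Cut G) (sym (source∈X⇒≡z u∈X)) cut-z))
      ...   | no  a≢u  = u , leaf-least-non-cut∈T block cb leaf (inj₁ least)
                           , non-cut-farthest-in-part block cb u∈X ¬cut-u a≢u v∈X

    T-at-least-as-far : TVert G a → ∀ v → ∃[ t ] (TVert G t × d a v ≤ d a t)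
    T-at-least-as-far a∈T v with Cut? v | a ≟ v
    ... | yes cut-v | _        = v , inj₁ cut-v , ≤-refl
    ... | no _      | yes refl = a , a∈T , ≤-refl
    ... | no ¬cut-v | no a≢v with geodesic-predecessor a≢v
    ... | y , y~v , dv with Cut? y | a ≟ y
    ... | yes cut-y | _        = T-within-one-of-cut cut-y (≤-reflexive (sym dv))
    ... | no ¬cut-a | yes refl =
      T-within-two ¬cut-a (≤-trans (≤-reflexive (trans (sym dv) (cong suc (d-self a)))) (s≤s z≤n))
    ... | no ¬cut-y | no a≢y =
      let (B , block , y∈B , v∈B) = edge-in-block y~v
          (X , Y , cb , v∈X) = orient (proj₂ (proj₂ (bipartition B block))) v∈B
          y∈Y = neighbour∈opposite cb v∈X y∈B (Edge-sym y~v)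
          (z , z∈X , dy) = predecessor∈opposite block (CompleteBipartite-swap cb) y∈Y ¬cut-y a≢y
      in T-at-least-as-far-as-v block cb v∈X ¬cut-v y∈Y ¬cut-y z∈X dv dy

lemma3p8 : ∀ {n : ℕ} (G : Graph n) → InClassB G
         → ∀ (a : Fin n) → TVert G a
         → ∃[ e ] (Ecc G (InS G ⊤) a e × Ecc G (TVert G) a e)
lemma3p8 G cls a a∈T =
  let (v , farthest) = argmax-Fin (d a) a
      (t , t∈T , dv≤dt) = T-at-least-as-far a a∈T v
  in d a v , Ecc-d (λ {w} _ → geodesic a w) ∈⊤ farthest
           , subst (Ecc G (TVert G) a) (≤-antisym (farthest t) dv≤dt)
                   (Ecc-d (T-geodesic a a∈T) t∈T (λ w → ≤-trans (farthest w) dv≤dt))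
  where
  open ClassB G cls
  open Distances G (proj₁ cls)
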